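{- Let $n\ge1$, $h\ge1$, $0\le\bar w\le n$, let $H$ be a multiset of $h$ binary strings each of length $n$ and weight $\bar w$, let $M=M(H)$, and let $f$ be a cumulative weight function that is a solution to $M$ and satisfies conditions (C1) and (C2). Let $m\in[2h]\setminus A(\bar w/2)$. If $(l,w)\in\mathcal{G}(f_m)$ is a merging point, then there are no branching points in $\mathcal{G}(f_m,[l])$.
   Context: Notation: $[n]=\{1,\dots,n\}$; $[n_1,n_2]=\{n_1,\dots,n_2\}$ if $n_1\le n_2$, else $\emptyset$. For a binary string $t$ of length $n$, $\mathrm{wt}(t)$ is its number of ones, $t[l]$, $t[-l]$ its length-$l$ prefix and suffix; $M(t)$ is the multiset union of $\{(j-\mathrm{wt}(t[j]),\mathrm{wt}(t[j])) : j\in[n]\}$ and $\{(j-\mathrm{wt}(t[-j]),\mathrm{wt}(t[-j])) : j\in[n]\}$, and $M(H)$ is the multiset union of $M(t)$, $t\in H$. A cumulative weight function (CWF) is $f:\{0,\dots,n\}\times[2h]\to\{0,\dots,n\}$ with (a) $f(0,m)=0$; (b) $f(l,m)-f(l-1,m)\in\{0,1\}$ for $(l,m)\in[n]\times[2h]$; (c) for each $j\in[h]$ there is $w_j$ with $f(l,2j-1)+f(n-l,2j)=w_j$ for all $l\in\{0,\dots,n\}$. Write $f_m(l)=f(l,m)$; $m^*=m-1$ if $m$ is even, $m^*=m+1$ if $m$ is odd. $f$ is a solution to $M$ if $M=\{(l-f_m(l),f_m(l)): m\in[2h],l\in[n]\}$ as multisets. $D(m_1,m_2)=\{l\in[n]:f_{m_1}(l)\ne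 f_{m_2}(l)\}$; a nonempty $[k_1,k_2]\subset[n]$ is a maximal interval between $f_{m_1}$ and $f_{m_2}$ if $[k_1,k_2]\subset D(m_1,m_2)$ and $k_1-1,k_2+1\notin D(m_1,m_2)$. Condition (C1): for any $m_1,m_2\in[2h]$ with $m_1^*=m_2$ there are at most two maximal intervals between $f_{m_1}$ and $f_{m_2}$. Condition (C2): for any $m_1,m_2\in[2h]$ with $m_1^*\ne m_2$ there is at most one maximal interval between $f_{m_1}$ and $f_{m_2}$. $\mathrm{med}(f_m)=\frac12(f_m(\lfloor n/2\rfloor)+f_m(\lceil n/2\rceil))$ and $A(w)=\{m\in[2h]:\mathrm{med}(f_m)=w\}$. For $I\subset\{0,\dots,n\}$, $\mathcal{G}(f_m,I)=\{(l,f_m(l)):l\in I\}$ and $\mathcal{G}(f_m)=\mathcal{G}(f_m,\{0,\dots,n\})$. With $A(l,w)=\{m\in[2h]:f_m(l)=w\}$, set for $(l,w)\in[n]^2$: $b_{l,w}=|A(l,w)\cap A(l-1,w)|$, $c_{l,w}=|A(l,w)\cap A(l-1,w-1)|$, and $b_{l,0}=|A(l,0)|$, $c_{l,0}=0$ for $l\in[n]$. A point $(l,w)\in\{0,\dots,n\}^2$ is a branching point if $b_{l,w}>0$ and $c_{l,w}>0$, and a merging point if $b_{l+1,w}>0$ and $c_{l+1,w+1}>0$. -}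

module Defs where

open import Data.Nat using (ℕ; zero; suc; _+_; _*_; _∸_; _≤_; _<_; _/_; _≡ᵇ_)
open import Data.Bool using (Bool; true; false; _∧_)
open import Data.List using (List; []; _∷_; map; concatMap; upTo; take; drop; length; filterᵇ; _++_)
open import Data.Vec using (Vec; toList)
open import Data.Product using (_×_; _,_; ∃)
open import Data.Sum using (_⊎_)
open import Relation.Binary.PropositionalEquality using (_≡_; _≢_)
open import Relation.Nullary using (¬_)
open import Data.List.Relation.Binary.Permutation.Propositional using (_↭_)
open import Data.Nat.Properties using (_≟_)
open import Relation.Nullary.Decidable using (⌊_⌋)

-- the list [a, a+1, ..., b]  (empty if b < a)
range : ℕ → ℕ → List ℕ
range a b = map (a +_) (upTo (suc b ∸ a))

wt : List Bool → ℕ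
wt [] = 0
wt (true ∷ t) = suc (wt t)
wt (false ∷ t) = wt t

-- M(t) as a list (multiset = list up to permutation)
Mstr : (n : ℕ) → Vec Bool n → List (ℕ × ℕ)
Mstr n t =
  map (λ j → (j ∸ wt (take j (toList t)) , wt (take j (toList t)))) (range 1 n)
  ++ map (λ j → (j ∸ wt (drop (n ∸ j) (toList t)) , wt (drop (n ∸ j) (toList t)))) (range 1 n)

MH : (n : ℕ) → List (Vec Bool n) → List (ℕ × ℕ)
MH n H = concatMap (Mstr n) H

record IsCWF (n h : ℕ) (f : ℕ → ℕ → ℕ) : Set where
  field
    codom : ∀ l m → l ≤ n → 1 ≤ m → m ≤ 2 * h → f l m ≤ n
    zero-at-0 : ∀ m → 1 ≤ m → m ≤ 2 * h → f 0 m ≡ 0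
    steps : ∀ l m → 1 ≤ l → l ≤ n → 1 ≤ m → m ≤ 2 * h →
            (f l m ≡ f (l ∸ 1) m) ⊎ (f l m ≡ suc (f (l ∸ 1) m))
    pairs : ∀ j → 1 ≤ j → j ≤ h →
            ∃ λ w → ∀ l → l ≤ n → f l (2 * j ∸ 1) + f (n ∸ l) (2 * j) ≡ w

IsSolution : (n h : ℕ) → (ℕ → ℕ → ℕ) → List (ℕ × ℕ) → Set
IsSolution n h f M =
  M ↭ concatMap (λ m → map (λ l → (l ∸ f l m , f l m)) (range 1 n)) (range 1 (2 * h))

even : ℕ → Bool
even zero = true
even (suc k) with even k
... | true = false
... | false = true

star : ℕ → ℕ
star m with even m
... | true = m ∸ 1
... | false = suc m

InD : (n : ℕ) → (ℕ → ℕ → ℕ) → ℕ → ℕ → ℕ → Set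
InD n f m1 m2 l = (1 ≤ l) × (l ≤ n) × (f l m1 ≢ f l m2)

MaxInterval : (n : ℕ) → (ℕ → ℕ → ℕ) → ℕ → ℕ → ℕ → ℕ → Set
MaxInterval n f m1 m2 k1 k2 =
  (k1 ≤ k2) × (∀ l → k1 ≤ l → l ≤ k2 → InD n f m1 m2 l)
  × ¬ InD n f m1 m2 (k1 ∸ 1) × ¬ InD n f m1 m2 (suc k2)

-- (C1): if m1* = m2, at most two maximal intervals
C1 : (n h : ℕ) → (ℕ → ℕ → ℕ) → Set
C1 n h f = ∀ m1 m2 → 1 ≤ m1 → m1 ≤ 2 * h → 1 ≤ m2 → m2 ≤ 2 * h → star m1 ≡ m2 →
  ∀ a1 b1 a2 b2 a3 b3 →
  MaxInterval n f m1 m2 a1 b1 → MaxInterval n f m1 m2 a2 b2 → MaxInterval n f m1 m2 a3 b3 →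
  ((a1 ≡ a2) × (b1 ≡ b2)) ⊎ ((a1 ≡ a3) × (b1 ≡ b3)) ⊎ ((a2 ≡ a3) × (b2 ≡ b3))

C2 : (n h : ℕ) → (ℕ → ℕ → ℕ) → Set
C2 n h f = ∀ m1 m2 → 1 ≤ m1 → m1 ≤ 2 * h → 1 ≤ m2 → m2 ≤ 2 * h → star m1 ≢ m2 →
  ∀ a1 b1 a2 b2 →
  MaxInterval n f m1 m2 a1 b1 → MaxInterval n f m1 m2 a2 b2 → (a1 ≡ a2) × (b1 ≡ b2)

-- twice the median: 2·med(f_m) = f_m(⌊n/2⌋) + f_m(⌈n/2⌉)
med2 : ℕ → (ℕ → ℕ → ℕ) → ℕ → ℕ
med2 n f m = f (n / 2) m + f (n ∸ n / 2) m

bcount : (h : ℕ) → (ℕ → ℕ → ℕ) → ℕ → ℕ → ℕ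
bcount h f l zero = length (filterᵇ (λ m → ⌊ f l m ≟ 0 ⌋) (range 1 (2 * h)))
bcount h f l (suc w) =
  length (filterᵇ (λ m → ⌊ f l m ≟ suc w ⌋ ∧ ⌊ f (l ∸ 1) m ≟ suc w ⌋) (range 1 (2 * h)))

ccount : (h : ℕ) → (ℕ → ℕ → ℕ) → ℕ → ℕ → ℕ
ccount h f l zero = 0
ccount h f l (suc w) =
  length (filterᵇ (λ m → ⌊ f l m ≟ suc w ⌋ ∧ ⌊ f (l ∸ 1) m ≟ w ⌋) (range 1 (2 * h)))

-- branching point (l,w) ∈ {0..n}²  (b, c only defined for l ∈ [n], w ≤ n)
Branching : (n h : ℕ) → (ℕ → ℕ → ℕ) → ℕ → ℕ → Set
Branching n h f l w = (1 ≤ l) × (l ≤ n) × (w ≤ n) × (0 < bcount h f l w) × (0 < ccount h f l w)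

-- merging point (l,w) ∈ {0..n}²  (needs l+1 ∈ [n], w+1 ≤ n)
Merging : (n h : ℕ) → (ℕ → ℕ → ℕ) → ℕ → ℕ → Set
Merging n h f l w = (suc l ≤ n) × (suc w ≤ n) × (0 < bcount h f (suc l) w) × (0 < ccount h f (suc l) (suc w))

{-# OPTIONS --safe #-}
module Submission where

-- Write D(x,y) for the set of levels at which f_x and f_y differ.  Every path ends at
-- height w̄, so the pair condition reads f_x(l) + f_{x*}(n − l) = w̄ and D(x,x*) is
-- symmetric under l ↦ n − l.  By (C2) D(x,y) has no gap when y ≠ x*, and by (C1)
-- D(x,x*) has at most one gap; a symmetric set with at most one gap that contains the
-- centre ⌈n/2⌉ has none, and ⌈n/2⌉ ∈ D(m,m*) exactly when med(f_m) ≠ w̄/2.  Hence f_m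
-- separates at most once from any path.  A branching point at level l₀ + 1 ≤ l yields a
-- path p that joins f_m at l₀ + 1 and never leaves it again, a merging point at l a path
-- q that follows f_m up to l and leaves it at l + 1.  Then p and q differ at l₀, agree at
-- l₀ + 1 and differ at l + 1, which (C2) forbids unless q = p*.  In that case the gap of
-- D(p,p*) between l₀ and l + 1 is straddled by the centre, where p and p* both agree
-- with f_m, and the pair condition gives 2 med(f_m) = f_p(⌊n/2⌋) + f_{p*}(⌈n/2⌉) = w̄.

open import Defs
open import Data.Bool using (Bool; true; false; not; T; _∧_)
open import Data.Bool.Properties using (T-∧)
open import Data.Empty using (⊥; ⊥-elim)
open import Data.List using (List; []; _∷_; length; map; take; drop; filterᵇ)
open import Data.List.Properties using (length-take; length-drop; take-all)
open import Data.List.Membership.Propositional using (_∈_; find; lose)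
open import Data.List.Membership.Propositional.Properties
  using (∈-map⁺; ∈-map⁻; ∈-++⁻; ∈-upTo⁺; ∈-upTo⁻; ∈-concatMap⁺; ∈-concatMap⁻)
open import Data.List.Relation.Binary.Permutation.Propositional using (↭-sym)
open import Data.List.Relation.Binary.Permutation.Propositional.Properties using (∈-resp-↭)
open import Data.List.Relation.Unary.All using (All)
import Data.List.Relation.Unary.All as All
open import Data.List.Relation.Unary.Any using (here; there)
open import Data.Nat
open import Data.Nat.DivMod using (m≡m%n+[m/n]*n; m%n<n; m/n*n≤m; m/n≤m)
open import Data.Nat.Properties
open import Data.Product using (∃; ∃₂; _×_; _,_; proj₁; proj₂)
open import Data.Sum using (_⊎_; inj₁; inj₂)
open import Data.Vec using (Vec; toList)
open import Data.Vec.Properties using (length-toList)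
open import Function using (_∘_)
open import Function.Bundles using (Equivalence)
open import Relation.Binary.Definitions using (tri<; tri≈; tri>)
open import Relation.Binary.PropositionalEquality
open import Relation.Nullary using (¬_; yes; no; ¬?)
open import Relation.Nullary.Decidable using (⌊_⌋; toWitness; decidable-stable; _×-dec_)
open import Relation.Unary using (Decidable)

wt≤length : ∀ xs → wt xs ≤ length xs
wt≤length []           = z≤n
wt≤length (true  ∷ xs) = s≤s (wt≤length xs)
wt≤length (false ∷ xs) = m≤n⇒m≤1+n (wt≤length xs)

∈-filterᵇ⁻ : ∀ {A : Set} (p : A → Bool) xs → 0 < length (filterᵇ p xs) →
             ∃ λ x → x ∈ xs × T (p x)
∈-filterᵇ⁻ p (x ∷ xs) nonempty with p x in px
... | true  = x , here refl , subst T (sym px) _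
... | false with y , y∈xs , py ← ∈-filterᵇ⁻ p xs nonempty = y , there y∈xs , py

<∸⇒+< : ∀ a {i n} → i < n ∸ a → a + i < n
<∸⇒+< zero    i<n             = i<n
<∸⇒+< (suc a) {n = suc n} i<n = s≤s (<∸⇒+< a i<n)

∈-range⁺ : ∀ {a b x} → a ≤ x → x ≤ b → x ∈ range a b
∈-range⁺ {a} {b} a≤x x≤b =
  subst (_∈ range a b) (m+[n∸m]≡n a≤x) (∈-map⁺ (a +_) (∈-upTo⁺ (∸-monoˡ-< (s≤s x≤b) a≤x)))

∈-range⁻ : ∀ {a b x} → x ∈ range a b → a ≤ x × x ≤ b
∈-range⁻ {a} x∈ with i , i∈ , refl ← ∈-map⁻ (a +_) x∈ =
  m≤m+n a i , ≤-pred (<∸⇒+< a (∈-upTo⁻ i∈))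

wt-take≤ : ∀ j xs → wt (take j xs) ≤ j
wt-take≤ j xs = ≤-trans (wt≤length (take j xs)) (≤-trans (≤-reflexive (length-take j xs)) (m⊓n≤m j _))

wt-drop≤ : ∀ {n} j xs → length xs ≡ n → j ≤ n → wt (drop (n ∸ j) xs) ≤ j
wt-drop≤ {n} j xs refl j≤n =
  ≤-trans (wt≤length (drop (n ∸ j) xs))
          (≤-reflexive (trans (length-drop (n ∸ j) xs) (m∸[m∸n]≡n j≤n)))

∈-Mstr⇒wt : ∀ n (t : Vec Bool n) {a w} → (a , w) ∈ Mstr n t → a + w ≡ n → w ≡ wt (toList t)
∈-Mstr⇒wt n t mem a+w≡n with ∈-++⁻ (map _ (range 1 n)) mem
... | inj₁ ∈prefixes with j , _ , refl ← ∈-map⁻ _ ∈prefixes =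
  trans (cong (λ k → wt (take k (toList t))) j≡n)
        (cong wt (take-all n (toList t) (≤-reflexive (length-toList t))))
  where
    j≡n : j ≡ n
    j≡n = trans (sym (m∸n+n≡m (wt-take≤ j (toList t)))) a+w≡n
... | inj₂ ∈suffixes with j , j∈ , refl ← ∈-map⁻ _ ∈suffixes =
  trans (cong (λ k → wt (drop (n ∸ k) (toList t))) j≡n) (cong (λ k → wt (drop k (toList t))) (n∸n≡0 n))
  where
    j≡n : j ≡ n
    j≡n = trans (sym (m∸n+n≡m (wt-drop≤ j (toList t) (length-toList t) (proj₂ (∈-range⁻ j∈))))) a+w≡n

Index : ℕ → ℕ → Set
Index h x = 1 ≤ x × x ≤ 2 * h

graph∈solution : ∀ {n h f M} → IsSolution n h f M → ∀ {x l} → Index h x → 1 ≤ l → l ≤ n →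
                 (l ∸ f l x , f l x) ∈ M
graph∈solution {n} {f = f} solution {x} (1≤x , x≤2h) 1≤l l≤n =
  ∈-resp-↭ (↭-sym solution)
    (∈-concatMap⁺ (λ m → map (λ l → (l ∸ f l m , f l m)) (range 1 n))
      (lose (∈-range⁺ 1≤x x≤2h) (∈-map⁺ (λ l → (l ∸ f l x , f l x)) (∈-range⁺ 1≤l l≤n))))

solution⇒endpoint : ∀ {n h w̄ f} (H : List (Vec Bool n)) → All (λ t → wt (toList t) ≡ w̄) H →
                    IsCWF n h f → IsSolution n h f (MH n H) → 1 ≤ n →
                    ∀ {x} → Index h x → f n x ≡ w̄
solution⇒endpoint {n} {h} {f = f} H weights cwf solution 1≤n {x} (1≤x , x≤2h)
  with t , t∈H , ∈Mt ← find (∈-concatMap⁻ (Mstr n) {xs = H}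
                               (graph∈solution {h = h} solution (1≤x , x≤2h) 1≤n ≤-refl)) =
  trans (∈-Mstr⇒wt n t ∈Mt (m∸n+n≡m (IsCWF.codom cwf n x ≤-refl 1≤x x≤2h)))
        (All.lookup weights t∈H)

even-2+ : ∀ k → even (suc (suc k)) ≡ even k
even-2+ k with even k
... | true  = refl
... | false = refl

even-double : ∀ k → even (2 * k) ≡ true
even-double zero    = refl
even-double (suc k) = trans (cong even (*-suc 2 k)) (trans (even-2+ (2 * k)) (even-double k))

even-suc : ∀ k → even (suc k) ≡ not (even k)
even-suc k with even k
... | true  = refl
... | false = refl

star-of-odd : ∀ m → even m ≡ false → star m ≡ suc m
star-of-odd m m-odd with even m
... | false = refl

star-of-even : ∀ m → even m ≡ true → star m ≡ m ∸ 1
star-of-even m m-even with even m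
... | true = refl

star-odd : ∀ k → star (suc (2 * k)) ≡ suc (suc (2 * k))
star-odd k = star-of-odd _ (trans (even-suc (2 * k)) (cong not (even-double k)))

star-even : ∀ k → star (suc (suc (2 * k))) ≡ suc (2 * k)
star-even k = star-of-even _ (trans (even-2+ (2 * k)) (even-double k))

data OddOrEven : ℕ → Set where
  1+2*_ : ∀ k → OddOrEven (suc (2 * k))
  2+2*_ : ∀ k → OddOrEven (suc (suc (2 * k)))

oddOrEven : ∀ m → OddOrEven (suc m)
oddOrEven zero = 1+2* 0
oddOrEven (suc m) with oddOrEven m
... | 1+2* k = 2+2* k
... | 2+2* k = subst (OddOrEven ∘ suc) (*-suc 2 k) (1+2* suc k)

odd-pair-index : ∀ {k h} → suc (2 * k) ≤ 2 * h → suc k ≤ h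
odd-pair-index {k} {h} = *-cancelˡ-< 2 k h

even-pair-index : ∀ {k h} → suc (suc (2 * k)) ≤ 2 * h → suc k ≤ h
even-pair-index {k} {h} le = *-cancelˡ-≤ 2 (subst (_≤ 2 * h) (sym (*-suc 2 k)) le)

pair-Index : ∀ {k h} → suc k ≤ h → Index h (suc (2 * k)) × Index h (suc (suc (2 * k)))
pair-Index {k} {h} 1+k≤h = (s≤s z≤n , ≤-trans (n≤1+n _) 2+2k≤2h) , (s≤s z≤n , 2+2k≤2h)
  where
    2+2k≤2h : suc (suc (2 * k)) ≤ 2 * h
    2+2k≤2h = subst (_≤ 2 * h) (*-suc 2 k) (*-monoʳ-≤ 2 1+k≤h)

star-Index : ∀ {h x} → Index h x → Index h (star x)
star-Index {h} {suc x} (_ , x≤2h) with oddOrEven x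
... | 1+2* k rewrite star-odd k  = proj₂ (pair-Index {k} {h} (odd-pair-index x≤2h))
... | 2+2* k rewrite star-even k = proj₁ (pair-Index {k} {h} (even-pair-index x≤2h))

n/2-bounds : ∀ n → n / 2 + n / 2 ≤ n × n ≤ suc (n / 2 + n / 2)
n/2-bounds n = subst (_≤ n) double (m/n*n≤m n 2) , subst (n ≤_) (cong suc double) upper
  where
    double : n / 2 * 2 ≡ n / 2 + n / 2
    double = trans (*-comm (n / 2) 2) (cong (n / 2 +_) (+-identityʳ (n / 2)))
    upper : n ≤ suc (n / 2 * 2)
    upper = ≤-trans (≤-reflexive (m≡m%n+[m/n]*n n 2)) (+-monoˡ-≤ (n / 2 * 2) (≤-pred (m%n<n n 2)))

n/2≤n∸n/2 : ∀ n → n / 2 ≤ n ∸ n / 2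
n/2≤n∸n/2 n = m+n≤o⇒m≤o∸n (n / 2) (proj₁ (n/2-bounds n))

≤n/2-or-mirror : ∀ n j → j ≤ n / 2 ⊎ n ∸ j ≤ n / 2
≤n/2-or-mirror n j with j ≤? n / 2
... | yes j≤a = inj₁ j≤a
... | no  j≰a =
  inj₂ (≤-trans (∸-monoʳ-≤ n (≰⇒> j≰a)) (m≤n+o⇒m∸n≤o n (suc (n / 2)) (proj₂ (n/2-bounds n))))

n∸n/2≤-or-mirror : ∀ {n j} → j ≤ n → n ∸ n / 2 ≤ j ⊎ n ∸ n / 2 ≤ n ∸ j
n∸n/2≤-or-mirror {n} {j} j≤n with ≤n/2-or-mirror n j
... | inj₁ j≤a   = inj₂ (∸-monoʳ-≤ n j≤a)
... | inj₂ n∸j≤a = inj₁ (subst (n ∸ n / 2 ≤_) (m∸[m∸n]≡n j≤n) (∸-monoʳ-≤ n n∸j≤a))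

-- IsMaximalRun (InD n f x y) unfolds to MaxInterval n f x y, so (C1) and (C2) are
-- instances of AtMostTwoRuns and AtMostOneRun below.
IsMaximalRun : (ℕ → Set) → ℕ → ℕ → Set
IsMaximalRun P a b = a ≤ b × (∀ l → a ≤ l → l ≤ b → P l) × ¬ P (a ∸ 1) × ¬ P (suc b)

AtMostOneRun : (ℕ → Set) → Set
AtMostOneRun P = ∀ {a₁ b₁ a₂ b₂} → IsMaximalRun P a₁ b₁ → IsMaximalRun P a₂ b₂ → a₁ ≡ a₂ × b₁ ≡ b₂

AtMostTwoRuns : (ℕ → Set) → Set
AtMostTwoRuns P = ∀ {a₁ b₁ a₂ b₂ a₃ b₃} →
                  IsMaximalRun P a₁ b₁ → IsMaximalRun P a₂ b₂ → IsMaximalRun P a₃ b₃ →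
                  (a₁ ≡ a₂ × b₁ ≡ b₂) ⊎ (a₁ ≡ a₃ × b₁ ≡ b₃) ⊎ (a₂ ≡ a₃ × b₂ ≡ b₃)

Gapless : (ℕ → Set) → Set
Gapless P = ∀ {i j k} → i < j → j < k → P i → ¬ P j → P k → ⊥

AtMostOneGap : (ℕ → Set) → Set
AtMostOneGap P = ∀ {i₁ j₁ i₂ j₂ i₃} → i₁ < j₁ → j₁ < i₂ → i₂ < j₂ → j₂ < i₃ →
                 P i₁ → ¬ P j₁ → P i₂ → ¬ P j₂ → P i₃ → ⊥

module _ {P : ℕ → Set} (gapless : Gapless P) where

  gapless-after : ∀ {i t} → P i → ¬ P (suc i) → suc i ≤ t → ¬ P t
  gapless-after {i} Pi ¬P1+i 1+i≤t Pt with m≤n⇒m<n∨m≡n 1+i≤t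
  ... | inj₁ 1+i<t = gapless (n<1+n i) 1+i<t Pi ¬P1+i Pt
  ... | inj₂ refl  = ¬P1+i Pt

  gapless-before : ∀ {k t} → ¬ P k → P (suc k) → t ≤ k → ¬ P t
  gapless-before {k} ¬Pk P1+k t≤k Pt with m≤n⇒m<n∨m≡n t≤k
  ... | inj₁ t<k = gapless t<k (n<1+n k) Pt ¬Pk P1+k
  ... | inj₂ refl = ¬Pk Pt

module MaximalRuns {P : ℕ → Set} (P? : Decidable P) (¬P0 : ¬ P 0)
                   {n : ℕ} (bounded : ∀ {l} → P l → l ≤ n) where

  runStart : ∀ k → P k → ∃ λ a → a ≤ k × (∀ l → a ≤ l → l ≤ k → P l) × ¬ P (a ∸ 1)
  runStart zero P0 = ⊥-elim (¬P0 P0)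
  runStart (suc k) P1+k with P? k
  ... | no ¬Pk = suc k , ≤-refl , (λ l a≤l l≤a → subst P (≤-antisym a≤l l≤a) P1+k) , ¬Pk
  ... | yes Pk with a , a≤k , run , ¬Pa-1 ← runStart k Pk = a , m≤n⇒m≤1+n a≤k , extended , ¬Pa-1
    where
      extended : ∀ l → a ≤ l → l ≤ suc k → P l
      extended l a≤l l≤1+k with m≤n⇒m<n∨m≡n l≤1+k
      ... | inj₁ l<1+k = run l a≤l (≤-pred l<1+k)
      ... | inj₂ refl  = P1+k

  runEnd : ∀ d {k} → n < d + k → P k →
           ∃ λ b → k ≤ b × (∀ l → k ≤ l → l ≤ b → P l) × ¬ P (suc b)
  runEnd zero n<k Pk = ⊥-elim (<⇒≱ n<k (bounded Pk))
  runEnd (suc d) {k} n<d+k Pk with P? (suc k)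
  ... | no ¬P1+k = k , ≤-refl , (λ l k≤l l≤k → subst P (≤-antisym k≤l l≤k) Pk) , ¬P1+k
  ... | yes P1+k with b , 1+k≤b , run , ¬P1+b ← runEnd d (subst (n <_) (sym (+-suc d k)) n<d+k) P1+k =
    b , ≤-trans (n≤1+n k) 1+k≤b , extended , ¬P1+b
    where
      extended : ∀ l → k ≤ l → l ≤ b → P l
      extended l k≤l l≤b with m≤n⇒m<n∨m≡n k≤l
      ... | inj₁ k<l = run l k<l l≤b
      ... | inj₂ refl = Pk

  maximalRun : ∀ {k} → P k → ∃₂ λ a b → IsMaximalRun P a b × a ≤ k × k ≤ b
  maximalRun {k} Pk
    with a , a≤k , left , ¬Pa-1 ← runStart k Pk
       | b , k≤b , right , ¬P1+b ← runEnd (suc n) (s≤s (m≤m+n n k)) Pk =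
    a , b , (≤-trans a≤k k≤b , run , ¬Pa-1 , ¬P1+b) , a≤k , k≤b
    where
      run : ∀ l → a ≤ l → l ≤ b → P l
      run l a≤l l≤b with ≤-total l k
      ... | inj₁ l≤k = left l a≤l l≤k
      ... | inj₂ k≤l = right l k≤l l≤b

  inRun : ∀ {a b l} → IsMaximalRun P a b → a ≤ l → l ≤ b → P l
  inRun (_ , run , _) = run _

  atMostOneRun⇒gapless : AtMostOneRun P → Gapless P
  atMostOneRun⇒gapless unique i<j j<k Pi ¬Pj Pk
    with _ , _ , run₁ , a₁≤i , _ ← maximalRun Pi
       | _ , _ , run₂ , _ , k≤b₂ ← maximalRun Pk
    with unique run₁ run₂
  ... | refl , refl = ¬Pj (inRun run₁ (≤-trans a₁≤i (<⇒≤ i<j)) (≤-trans (<⇒≤ j<k) k≤b₂))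

  atMostTwoRuns⇒atMostOneGap : AtMostTwoRuns P → AtMostOneGap P
  atMostTwoRuns⇒atMostOneGap twoRuns i₁<j₁ j₁<i₂ i₂<j₂ j₂<i₃ P₁ ¬Q₁ P₂ ¬Q₂ P₃
    with _ , _ , run₁ , a₁≤i₁ , _ ← maximalRun P₁
       | _ , _ , run₂ , a₂≤i₂ , i₂≤b₂ ← maximalRun P₂
       | _ , _ , run₃ , _ , i₃≤b₃ ← maximalRun P₃
    with twoRuns run₁ run₂ run₃
  ... | inj₁ (refl , refl) =
    ¬Q₁ (inRun run₁ (≤-trans a₁≤i₁ (<⇒≤ i₁<j₁)) (≤-trans (<⇒≤ j₁<i₂) i₂≤b₂))
  ... | inj₂ (inj₁ (refl , refl)) =
    ¬Q₁ (inRun run₁ (≤-trans a₁≤i₁ (<⇒≤ i₁<j₁))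
                    (≤-trans (<⇒≤ (<-trans j₁<i₂ (<-trans i₂<j₂ j₂<i₃))) i₃≤b₃))
  ... | inj₂ (inj₂ (refl , refl)) =
    ¬Q₂ (inRun run₂ (≤-trans a₂≤i₂ (<⇒≤ i₂<j₂)) (≤-trans (<⇒≤ j₂<i₃) i₃≤b₃))

module MirrorSymmetric {P : ℕ → Set} {n : ℕ} (bounded : ∀ {l} → P l → l ≤ n)
                       (mirror : ∀ {l} → P l → P (n ∸ l)) (atMostOneGap : AtMostOneGap P) where

  below-P : ∀ {j k} → j < k → P k → j ≤ n
  below-P j<k Pk = ≤-trans (<⇒≤ j<k) (bounded Pk)

  mirror-¬ : ∀ {j} → j ≤ n → ¬ P j → ¬ P (n ∸ j)
  mirror-¬ j≤n ¬Pj Pn∸j = ¬Pj (subst P (m∸[m∸n]≡n j≤n) (mirror Pn∸j))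

  P-outside-gap-and-mirror : ∀ {i j k c} → i < j → j < k → P i → ¬ P j → P k → P c →
                           (c < j × c < n ∸ j) ⊎ (j < c × n ∸ j < c)
  P-outside-gap-and-mirror {i} {j} {k} {c} i<j j<k Pi ¬Pj Pk Pc with <-cmp c j | <-cmp c (n ∸ j)
  ... | tri≈ _ refl _ | _             = ⊥-elim (¬Pj Pc)
  ... | _             | tri≈ _ refl _ = ⊥-elim (mirror-¬ (below-P j<k Pk) ¬Pj Pc)
  ... | tri< c<j _ _  | tri< c<j′ _ _ = inj₁ (c<j , c<j′)
  ... | tri> _ _ j<c  | tri> _ _ j′<c = inj₂ (j<c , j′<c)
  ... | tri< c<j _ _  | tri> _ _ j′<c = ⊥-elim (
    atMostOneGap (∸-monoʳ-< j<k (bounded Pk)) j′<c c<j j<k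
                 (mirror Pk) (mirror-¬ (below-P j<k Pk) ¬Pj) Pc ¬Pj Pk)
  ... | tri> _ _ j<c  | tri< c<j′ _ _ = ⊥-elim (
    atMostOneGap i<j j<c c<j′ (∸-monoʳ-< i<j (below-P j<k Pk))
                 Pi ¬Pj Pc (mirror-¬ (below-P j<k Pk) ¬Pj) (mirror Pi))

  centre⇒gapless : P (n ∸ n / 2) → Gapless P
  centre⇒gapless Pb {j = j} i<j j<k Pi ¬Pj Pk with P-outside-gap-and-mirror i<j j<k Pi ¬Pj Pk Pb
  ... | inj₁ (b<j , b<j′) with ≤n/2-or-mirror n j
  ...   | inj₁ j≤a  = <⇒≱ b<j (≤-trans j≤a (n/2≤n∸n/2 n))
  ...   | inj₂ j′≤a = <⇒≱ b<j′ (≤-trans j′≤a (n/2≤n∸n/2 n))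
  centre⇒gapless Pb i<j j<k Pi ¬Pj Pk | inj₂ (j<b , j′<b) with n∸n/2≤-or-mirror (below-P j<k Pk)
  ...   | inj₁ b≤j  = <⇒≱ j<b b≤j
  ...   | inj₂ b≤j′ = <⇒≱ j′<b b≤j′

  gap-straddles-centre : ∀ {i j} → i < j → P i → ¬ P (suc i) → ¬ P j → P (suc j) →
                         suc i ≤ n / 2 × n ∸ n / 2 ≤ j
  gap-straddles-centre {i} {j} i<j Pi ¬P1+i ¬Pj P1+j = left , right
    where
      left : suc i ≤ n / 2
      left with P-outside-gap-and-mirror (n<1+n i) (s≤s i<j) Pi ¬P1+i P1+j Pi | ≤n/2-or-mirror n (suc i)
      ... | inj₂ (1+i<i , _) | _         = ⊥-elim (<⇒≱ 1+i<i (n≤1+n i))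
      ... | inj₁ _           | inj₁ 1+i≤a = 1+i≤a
      ... | inj₁ (_ , i<i′)  | inj₂ i′≤a = ≤-trans i<i′ i′≤a
      right : n ∸ n / 2 ≤ j
      right with P-outside-gap-and-mirror i<j (n<1+n j) Pi ¬Pj P1+j P1+j
                 | n∸n/2≤-or-mirror (<⇒≤ (bounded P1+j))
      ... | inj₁ (1+j<j , _) | _         = ⊥-elim (<⇒≱ 1+j<j (n≤1+n j))
      ... | inj₂ _           | inj₁ b≤j  = b≤j
      ... | inj₂ (_ , j′<1+j) | inj₂ b≤j′ = ≤-trans b≤j′ (≤-pred j′<1+j)

module CWF {n h : ℕ} {f : ℕ → ℕ → ℕ} (cwf : IsCWF n h f) where
  open IsCWF cwf

  InD? : ∀ x y → Decidable (InD n f x y)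
  InD? x y l = (1 ≤? l) ×-dec (l ≤? n) ×-dec ¬? (f l x ≟ f l y)

  differ⇒InD : ∀ {x y l} → Index h x → Index h y → l ≤ n → f l x ≢ f l y → InD n f x y l
  differ⇒InD {x} {y} {zero} (1≤x , x≤2h) (1≤y , y≤2h) _ differ =
    ⊥-elim (differ (trans (zero-at-0 x 1≤x x≤2h) (sym (zero-at-0 y 1≤y y≤2h))))
  differ⇒InD {l = suc l} _ _ l≤n differ = s≤s z≤n , l≤n , differ

  agree⇒¬InD : ∀ {x y l} → f l x ≡ f l y → ¬ InD n f x y l
  agree⇒¬InD agree (_ , _ , differ) = differ agree

  ¬InD⇒agree : ∀ {x y l} → Index h x → Index h y → l ≤ n → ¬ InD n f x y l → f l x ≡ f l y
  ¬InD⇒agree {x} {y} {l} x-idx y-idx l≤n ¬D =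
    decidable-stable (f l x ≟ f l y) (¬D ∘ differ⇒InD x-idx y-idx l≤n)

  module InDRuns (x y : ℕ) = MaximalRuns (InD? x y) (λ ()) (proj₁ ∘ proj₂)

  C2⇒gapless : C2 n h f → ∀ {x y} → Index h x → Index h y → star x ≢ y → Gapless (InD n f x y)
  C2⇒gapless c2 {x} {y} (1≤x , x≤2h) (1≤y , y≤2h) x*≢y =
    InDRuns.atMostOneRun⇒gapless x y
      (λ {a₁} {b₁} {a₂} {b₂} → c2 x y 1≤x x≤2h 1≤y y≤2h x*≢y a₁ b₁ a₂ b₂)

  C1⇒atMostOneGap : C1 n h f → ∀ {x} → Index h x → AtMostOneGap (InD n f x (star x))
  C1⇒atMostOneGap c1 {x} (1≤x , x≤2h) with 1≤x* , x*≤2h ← star-Index {h} (1≤x , x≤2h) =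
    InDRuns.atMostTwoRuns⇒atMostOneGap x (star x)
      (λ {a₁} {b₁} {a₂} {b₂} {a₃} {b₃} → c1 x (star x) 1≤x x≤2h 1≤x* x*≤2h refl a₁ b₁ a₂ b₂ a₃ b₃)

  T-≟∧≟ : ∀ {a b c d} → T (⌊ a ≟ b ⌋ ∧ ⌊ c ≟ d ⌋) → a ≡ b × c ≡ d
  T-≟∧≟ {a} {b} {c} {d} both
    with T[a≟b] , T[c≟d] ← Equivalence.to (T-∧ {⌊ a ≟ b ⌋} {⌊ c ≟ d ⌋}) both =
    toWitness T[a≟b] , toWitness T[c≟d]

  bcount-witness : ∀ {l w} → 1 ≤ l → l ≤ n → 0 < bcount h f l w →
                   ∃ λ c → Index h c × f l c ≡ w × f (l ∸ 1) c ≡ w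
  bcount-witness {l} {zero} 1≤l l≤n positive
    with c , c∈ , T[fc≟0] ← ∈-filterᵇ⁻ _ (range 1 (2 * h)) positive
    with 1≤c , c≤2h ← ∈-range⁻ c∈
    with steps l c 1≤l l≤n 1≤c c≤2h
  ... | inj₁ flat = c , (1≤c , c≤2h) , toWitness T[fc≟0] , trans (sym flat) (toWitness T[fc≟0])
  ... | inj₂ step = ⊥-elim (1+n≢0 (trans (sym step) (toWitness T[fc≟0])))
  bcount-witness {l} {suc w} _ _ positive
    with c , c∈ , T[both] ← ∈-filterᵇ⁻ _ (range 1 (2 * h)) positive =
    c , ∈-range⁻ c∈ , T-≟∧≟ T[both]

  ccount-witness : ∀ {l w} → 0 < ccount h f l (suc w) →
                   ∃ λ c → Index h c × f l c ≡ suc w × f (l ∸ 1) c ≡ w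
  ccount-witness positive
    with c , c∈ , T[both] ← ∈-filterᵇ⁻ _ (range 1 (2 * h)) positive =
    c , ∈-range⁻ c∈ , T-≟∧≟ T[both]

  branching⇒joining-path : ∀ {m l w} → f (suc l) m ≡ w → Branching n h f (suc l) w →
                           ∃ λ p → Index h p × f l m ≢ f l p × f (suc l) m ≡ f (suc l) p
  branching⇒joining-path {w = zero} _ (_ , _ , _ , _ , ())
  branching⇒joining-path {m} {l} {suc w} fm≡w (1≤l , l≤n , _ , b>0 , c>0)
    with c , c-idx , fc≡w , fc′≡w ← bcount-witness 1≤l l≤n b>0
       | d , d-idx , fd≡w , fd′≡w-1 ← ccount-witness c>0
    with f l m ≟ f l c
  ... | yes fm≡fc =
    d , d-idx , (λ fm≡fd → 1+n≢n (trans (sym fc′≡w) (trans (sym fm≡fc) (trans fm≡fd fd′≡w-1)))) ,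
    trans fm≡w (sym fd≡w)
  ... | no fm≢fc  = c , c-idx , fm≢fc , trans fm≡w (sym fc≡w)

  merging⇒leaving-path : ∀ {m l w} → f l m ≡ w → Merging n h f l w →
                         ∃ λ q → Index h q × f l m ≡ f l q × f (suc l) m ≢ f (suc l) q
  merging⇒leaving-path {m} {l} {w} fm≡w (1+l≤n , _ , b>0 , c>0)
    with c , c-idx , fc≡w , fc′≡w ← bcount-witness (s≤s z≤n) 1+l≤n b>0
       | d , d-idx , fd≡1+w , fd′≡w ← ccount-witness c>0
    with f (suc l) m ≟ f (suc l) c
  ... | yes fm≡fc = d , d-idx , trans fm≡w (sym fd′≡w) ,
                    (λ fm≡fd → 1+n≢n (trans (sym fd≡1+w) (trans (sym fm≡fd) (trans fm≡fc fc≡w))))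
  ... | no fm≢fc  = c , c-idx , trans fm≡w (sym fc′≡w) , fm≢fc

  module Mirror {w̄ : ℕ} (endpoint : ∀ {x} → Index h x → f n x ≡ w̄) where

    pair-sum : ∀ {k l} → suc k ≤ h → l ≤ n → f l (suc (2 * k)) + f (n ∸ l) (suc (suc (2 * k))) ≡ w̄
    pair-sum {k} {l} 1+k≤h l≤n with w , sum≡w ← pairs (suc k) (s≤s z≤n) 1+k≤h = begin
      f l (suc (2 * k)) + f (n ∸ l) (suc (suc (2 * k))) ≡⟨ sum l l≤n ⟩
      w                                                  ≡⟨ sym (sum n ≤-refl) ⟩
      f n (suc (2 * k)) + f (n ∸ n) (suc (suc (2 * k))) ≡⟨ cong₂ _+_ (endpoint odd-idx) start ⟩
      w̄ + 0                                              ≡⟨ +-identityʳ w̄ ⟩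
      w̄                                                  ∎
      where
        open ≡-Reasoning
        sum : ∀ l → l ≤ n → f l (suc (2 * k)) + f (n ∸ l) (suc (suc (2 * k))) ≡ w
        sum = subst (λ i → ∀ l → l ≤ n → f l (i ∸ 1) + f (n ∸ l) i ≡ w) (*-suc 2 k) sum≡w
        odd-idx = proj₁ (pair-Index {k} {h} 1+k≤h)
        even-idx = proj₂ (pair-Index {k} {h} 1+k≤h)
        start : f (n ∸ n) (suc (suc (2 * k))) ≡ 0
        start rewrite n∸n≡0 n = zero-at-0 _ (proj₁ even-idx) (proj₂ even-idx)

    mirror-sum : ∀ {x k} → Index h x → k ≤ n → f k x + f (n ∸ k) (star x) ≡ w̄
    mirror-sum {suc x} {k} (_ , x≤2h) k≤n with oddOrEven x
    ... | 1+2* j rewrite star-odd j = pair-sum (odd-pair-index {j} {h} x≤2h) k≤n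
    ... | 2+2* j rewrite star-even j = begin
      f k x₂ + f (n ∸ k) x₁              ≡⟨ +-comm (f k x₂) _ ⟩
      f (n ∸ k) x₁ + f k x₂              ≡⟨ cong (λ i → f (n ∸ k) x₁ + f i x₂) (sym (m∸[m∸n]≡n k≤n)) ⟩
      f (n ∸ k) x₁ + f (n ∸ (n ∸ k)) x₂  ≡⟨ pair-sum (even-pair-index {j} {h} x≤2h) (m∸n≤m n k) ⟩
      w̄                                  ∎
      where
        open ≡-Reasoning
        x₁ = suc (2 * j)
        x₂ = suc x₁

    mirror-agree : ∀ {x k} → Index h x → k ≤ n →
                   f k x ≡ f k (star x) → f (n ∸ k) x ≡ f (n ∸ k) (star x)
    mirror-agree {x} {k} x-idx k≤n agree = +-cancelˡ-≡ (f k x) _ _ (begin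
      f k x + f (n ∸ k) x                     ≡⟨ +-comm (f k x) _ ⟩
      f (n ∸ k) x + f k x                     ≡⟨ cong (f (n ∸ k) x +_) agree ⟩
      f (n ∸ k) x + f k (star x)              ≡⟨ cong (λ i → f (n ∸ k) x + f i (star x)) (sym (m∸[m∸n]≡n k≤n)) ⟩
      f (n ∸ k) x + f (n ∸ (n ∸ k)) (star x)  ≡⟨ mirror-sum x-idx (m∸n≤m n k) ⟩
      w̄                                       ≡⟨ sym (mirror-sum x-idx k≤n) ⟩
      f k x + f (n ∸ k) (star x)              ∎)
      where open ≡-Reasoning

    mirror-InD : ∀ {x k} → Index h x → InD n f x (star x) k → InD n f x (star x) (n ∸ k)
    mirror-InD {x} {k} x-idx (_ , k≤n , differ) =
      differ⇒InD x-idx (star-Index {h} x-idx) (m∸n≤m n k)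
        (λ agree → differ (subst (λ i → f i x ≡ f i (star x)) (m∸[m∸n]≡n k≤n)
                                 (mirror-agree x-idx (m∸n≤m n k) agree)))

    med2≢w̄⇒centre∈InD : ∀ {m} → Index h m → med2 n f m ≢ w̄ → InD n f m (star m) (n ∸ n / 2)
    med2≢w̄⇒centre∈InD {m} m-idx med≢w̄ =
      differ⇒InD m-idx (star-Index {h} m-idx) (m∸n≤m n (n / 2))
        (λ agree → med≢w̄ (trans (cong (f (n / 2) m +_) agree) (mirror-sum m-idx (m/n≤m n 2))))

    module _ (c1 : C1 n h f) (c2 : C2 n h f) where

      module Partners {x} (x-idx : Index h x) =
        MirrorSymmetric {InD n f x (star x)} (proj₁ ∘ proj₂) (mirror-InD x-idx) (C1⇒atMostOneGap c1 x-idx)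

      module _ {m} (m-idx : Index h m) (med≢w̄ : med2 n f m ≢ w̄) where

        gapless-from : ∀ {y} → Index h y → Gapless (InD n f m y)
        gapless-from {y} y-idx with star m ≟ y
        ... | yes refl = Partners.centre⇒gapless m-idx (med2≢w̄⇒centre∈InD m-idx med≢w̄)
        ... | no m*≢y  = C2⇒gapless c2 m-idx y-idx m*≢y

        joining-path-stays : ∀ {p l₀} → Index h p → f l₀ m ≢ f l₀ p → f (suc l₀) m ≡ f (suc l₀) p →
                             ∀ {t} → suc l₀ ≤ t → t ≤ n → f t m ≡ f t p
        joining-path-stays p-idx differ agree 1+l₀≤t t≤n =
          ¬InD⇒agree m-idx p-idx t≤n
            (gapless-after (gapless-from p-idx)
              (differ⇒InD m-idx p-idx (≤-trans (n≤1+n _) (≤-trans 1+l₀≤t t≤n)) differ)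
              (agree⇒¬InD agree) 1+l₀≤t)

        leaving-path-follows : ∀ {q l} → Index h q → suc l ≤ n → f l m ≡ f l q → f (suc l) m ≢ f (suc l) q →
                               ∀ {t} → t ≤ l → f t m ≡ f t q
        leaving-path-follows q-idx 1+l≤n agree differ t≤l =
          ¬InD⇒agree m-idx q-idx (≤-trans t≤l (<⇒≤ 1+l≤n))
            (gapless-before (gapless-from q-idx)
              (agree⇒¬InD agree) (differ⇒InD m-idx q-idx 1+l≤n differ) t≤l)

        no-gap-between-trackers : ∀ {p q l₀ l} → Index h p → Index h q → l₀ < l →
                                  (∀ {t} → suc l₀ ≤ t → t ≤ n → f t m ≡ f t p) →
                                  (∀ {t} → t ≤ l → f t m ≡ f t q) →
                                  InD n f p q l₀ → ¬ InD n f p q (suc l₀) →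
                                  ¬ InD n f p q l → InD n f p q (suc l) → ⊥
        no-gap-between-trackers {p} {q} {l₀} p-idx q-idx l₀<l p≈m q≈m D₀ ¬D₁ ¬Dₗ D₂ with star p ≟ q
        ... | no p*≢q  = C2⇒gapless c2 p-idx q-idx p*≢q (n<1+n l₀) (s≤s l₀<l) D₀ ¬D₁ D₂
        ... | yes refl with 1+l₀≤a , b≤l ← Partners.gap-straddles-centre p-idx l₀<l D₀ ¬D₁ ¬Dₗ D₂ =
          med≢w̄ (begin
            f (n / 2) m + f (n ∸ n / 2) m        ≡⟨ cong₂ _+_ (p≈m 1+l₀≤a (m/n≤m n 2)) (q≈m b≤l) ⟩
            f (n / 2) p + f (n ∸ n / 2) (star p) ≡⟨ mirror-sum p-idx (m/n≤m n 2) ⟩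
            w̄                                    ∎)
          where open ≡-Reasoning

        no-join-before-leave : ∀ {p q l₀ l} → Index h p → Index h q → l₀ < l → suc l ≤ n →
                               f l₀ m ≢ f l₀ p → f (suc l₀) m ≡ f (suc l₀) p →
                               f l m ≡ f l q → f (suc l) m ≢ f (suc l) q → ⊥
        no-join-before-leave p-idx q-idx l₀<l 1+l≤n m≢p₀ m≡p₁ m≡q m≢q₁ =
          no-gap-between-trackers p-idx q-idx l₀<l p≈m q≈m
            (differ⇒InD p-idx q-idx (≤-trans (<⇒≤ l₀<l) l≤n)
              (λ p≡q → m≢p₀ (trans (q≈m (<⇒≤ l₀<l)) (sym p≡q))))
            (agree⇒¬InD (trans (sym (p≈m ≤-refl (≤-trans l₀<l l≤n))) (q≈m l₀<l)))
            (agree⇒¬InD (trans (sym (p≈m l₀<l l≤n)) (q≈m ≤-refl)))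
            (differ⇒InD p-idx q-idx 1+l≤n
              (λ p≡q → m≢q₁ (trans (p≈m (s≤s (<⇒≤ l₀<l)) 1+l≤n) p≡q)))
          where
            l≤n = <⇒≤ 1+l≤n
            p≈m = joining-path-stays p-idx m≢p₀ m≡p₁
            q≈m = leaving-path-follows q-idx 1+l≤n m≡q m≢q₁

lemma3 : (n h w̄ : ℕ) → 1 ≤ n → 1 ≤ h → w̄ ≤ n →
         (H : List (Vec Bool n)) → length H ≡ h → All (λ t → wt (toList t) ≡ w̄) H →
         (f : ℕ → ℕ → ℕ) → IsCWF n h f → IsSolution n h f (MH n H) →
         C1 n h f → C2 n h f →
         (m : ℕ) → 1 ≤ m → m ≤ 2 * h → med2 n f m ≢ w̄ →
         (l : ℕ) → l ≤ n → Merging n h f l (f l m) →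
         ∀ l′ → 1 ≤ l′ → l′ ≤ l → ¬ Branching n h f l′ (f l′ m)
lemma3 n h w̄ 1≤n _ _ H _ weights f cwf solution c1 c2 m 1≤m m≤2h med≢w̄ l _ merging
       (suc l₀) _ 1+l₀≤l branching =
  let p , p-idx , m≢p , m≡p = branching⇒joining-path refl branching
      q , q-idx , m≡q , m≢q = merging⇒leaving-path refl merging
  in no-join-before-leave c1 c2 (1≤m , m≤2h) med≢w̄ p-idx q-idx 1+l₀≤l (proj₁ merging)
                          m≢p m≡p m≡q m≢q
  where
    open CWF cwf
    open Mirror (solution⇒endpoint H weights cwf solution 1≤n)
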